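{- For any connected graph $G$ of order $n \ge 2$, $$\Delta(G) - 1 \le Z(L(G)) \le |E(G)| - (\delta(G) - 1),$$ and both bounds are sharp (the lower bound is attained by $G = K_{1,n-1}$ and the upper bound by $G = K_n$).
   Context: All graphs are finite, simple and undirected. $\Delta(G)$ and $\delta(G)$ are the maximum and minimum degree of $G$. $L(G)$ is the line graph of $G$ (vertex set $E(G)$, adjacency meaning sharing an endpoint). Zero forcing: each vertex of a graph $H$ is colored black or white; the color-change rule says that if a black vertex $u$ has exactly one white neighbor $w$, then $w$ becomes black. A set $S \subseteq V(H)$ is a zero forcing set if, starting with exactly the vertices of $S$ black, repeated application of the color-change rule eventually makes all vertices black. The zero forcing number $Z(H)$ is the minimum size of a zero forcing set of $H$. -}

module Defs where

open import Data.Bool using (Bool; true; false; not; _∧_; _∨_; if_then_else_)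
open import Data.Nat using (ℕ; zero; suc; _≤_; _⊔_; _⊓_; _<ᵇ_)
open import Data.Fin using (Fin; zero; suc; toℕ; _≟_)
open import Data.Fin.Subset using (Subset; _∈_; _∉_; _∪_; ⁅_⁆; ∣_∣)
open import Data.List using (List; []; _∷_; length; map; foldr; concatMap; lookup; allFin)
open import Data.Product using (Σ; _×_; _,_; proj₁; proj₂)
open import Relation.Binary.PropositionalEquality using (_≡_; _≢_)
open import Relation.Binary.Construct.Closure.ReflexiveTransitive using (Star)
open import Relation.Nullary.Decidable using (⌊_⌋)

record Graph (n : ℕ) : Set where
  constructor mkGraph
  field
    adj : Fin n → Fin n → Bool
open Graph public

Simple : {n : ℕ} → Graph n → Set
Simple {n} G = ((u v : Fin n) → adj G u v ≡ adj G v u) × ((u : Fin n) → adj G u u ≡ false)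

Adj : {n : ℕ} → Graph n → Fin n → Fin n → Set
Adj G u v = adj G u v ≡ true

Connected : {n : ℕ} → Graph n → Set
Connected {n} G = (u v : Fin n) → Star (Adj G) u v

countTrue : List Bool → ℕ
countTrue [] = 0
countTrue (true ∷ bs) = suc (countTrue bs)
countTrue (false ∷ bs) = countTrue bs

deg : {n : ℕ} → Graph n → Fin n → ℕ
deg {n} G v = countTrue (map (adj G v) (allFin n))

maxDeg : {n : ℕ} → Graph n → ℕ
maxDeg {n} G = foldr _⊔_ 0 (map (deg G) (allFin n))

-- Minimum degree δ(G) (only meaningful for n ≥ 1; value 0 for the empty graph).
minDeg : {n : ℕ} → Graph n → ℕ
minDeg {zero} G = 0
minDeg {suc n} G = foldr _⊓_ (deg G zero) (map (deg G) (allFin (suc n)))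

edges : {n : ℕ} → Graph n → List (Fin n × Fin n)
edges {n} G =
  concatMap (λ i → concatMap (λ j →
      if (toℕ i <ᵇ toℕ j) ∧ adj G i j then (i , j) ∷ [] else []) (allFin n)) (allFin n)

numEdges : {n : ℕ} → Graph n → ℕ
numEdges G = length (edges G)

shareEnd : {n : ℕ} → Fin n × Fin n → Fin n × Fin n → Bool
shareEnd (a , b) (c , d) = ⌊ a ≟ c ⌋ ∨ ⌊ a ≟ d ⌋ ∨ ⌊ b ≟ c ⌋ ∨ ⌊ b ≟ d ⌋

lineGraph : {n : ℕ} → (G : Graph n) → Graph (numEdges G)
lineGraph G = mkGraph (λ e f → not ⌊ e ≟ f ⌋ ∧ shareEnd (lookup (edges G) e) (lookup (edges G) f))

data Force {n : ℕ} (H : Graph n) : Subset n → Subset n → Set where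
  force : {S : Subset n} (u w : Fin n) →
          u ∈ S → w ∉ S → Adj H u w →
          ((x : Fin n) → Adj H u x → x ≢ w → x ∈ S) →
          Force H S (S ∪ ⁅ w ⁆)

IsZeroForcingSet : {n : ℕ} → Graph n → Subset n → Set
IsZeroForcingSet {n} H S = Σ (Subset n) λ T → Star (Force H) S T × ((v : Fin n) → v ∈ T)

ZeroForcingNumber : {n : ℕ} → Graph n → ℕ → Set
ZeroForcingNumber {n} H k =
  (Σ (Subset n) λ S → IsZeroForcingSet H S × ∣ S ∣ ≡ k) ×
  ((S : Subset n) → IsZeroForcingSet H S → k ≤ ∣ S ∣)

complete : (n : ℕ) → Graph n
complete n = mkGraph (λ i j → not ⌊ i ≟ j ⌋)

starAdj : {m : ℕ} → Fin (suc m) → Fin (suc m) → Bool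
starAdj zero zero = false
starAdj zero (suc _) = true
starAdj (suc _) zero = true
starAdj (suc _) (suc _) = false

star : (m : ℕ) → Graph (suc m)
star m = mkGraph starAdj

module Submission where

-- Lower bound: the Δ edges at a vertex of maximum degree form a clique K in L(G). Along a
-- forcing chain the number of black vertices with a white neighbour never increases, and once
-- K has a single white vertex all its other vertices are such; hence |S| ≥ |K| − 1.
-- Upper bound: pick a vertex c and a set X of δ − 1 of its neighbours, and colour white exactly
-- the edges cx with x ∈ X. Each x ∈ X has a neighbour y ∉ X ∪ {c}; the black edge xy then
-- has cx as its only white neighbour, so the white edges are forced one by one.
-- Sharpness: L(K_{1,m}) is complete, so all its vertices but one form a zero forcing set. For
-- K_n we have δ − 1 = n − 2, and in any zero forcing set of L(G) at most n − 2 edges are white: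
-- the white edges cover more vertices than their number (each force uncovers the vertex shared
-- by the forcing and the forced edge), while an endpoint of the first forcing edge is uncovered.

open import Defs
open import Data.Bool using (Bool; true; false; not; _∧_; _∨_; if_then_else_)
open import Data.Bool.Properties
  using (∨-zeroʳ; ∧-zeroʳ; ∧-identityʳ; ∨-identityʳ; ∧-inverseʳ; not-¬; ¬-not; not-injective; T-≡; ∨-∧-booleanAlgebra)
  renaming (_≟_ to _≟ᵇ_)
open import Algebra.Lattice.Properties.BooleanAlgebra ∨-∧-booleanAlgebra using (deMorgan₂)
open import Data.Empty using (⊥-elim)
open import Data.Fin using (Fin; zero; suc; toℕ; _≟_)
open import Data.Fin.Properties using (toℕ-injective; any?) renaming (suc-injective to fsuc-injective)
open import Data.Fin.Subset using (Subset; _∈_; _∉_; _∪_; ⁅_⁆; ∣_∣; ∁)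
open import Data.Fin.Subset.Properties
  using (x∈⁅x⁆; x∈⁅y⁆⇒x≡y; ∣∁p∣≡n∸∣p∣; ∣⁅x⁆∣≡1; x∉p⇒x∈∁p; x∈p⇒x∉∁p; x∈p∪q⁺)
open import Data.List using (List; []; _∷_; _++_; map; foldr; concatMap; lookup; tabulate)
open import Data.List.Properties using (map-++)
open import Data.Nat using (ℕ; zero; suc; _≤_; _<_; _+_; _∸_; _⊔_; _⊓_; _<ᵇ_; _≤?_; z≤n; s≤s)
open import Data.Nat.Properties hiding (_≟_)
open import Algebra.Properties.CommutativeMonoid.Sum +-0-commutativeMonoid
  using (sum; sum-cong-≗; ∑-distrib-+)
import Data.Vec as Vec
import Data.Vec.Properties as Vec
open import Data.Product using (∃-syntax; _×_; _,_; proj₁; proj₂)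
open import Data.Sum using (_⊎_; inj₁; inj₂; [_,_]′)
open import Function using (_∘_; Equivalence)
open import Relation.Binary.PropositionalEquality
open import Relation.Binary.Construct.Closure.ReflexiveTransitive using (Star; ε; _◅_)
open import Relation.Binary using (tri<; tri≈; tri>)
open import Relation.Nullary using (¬_; yes; no)
open import Relation.Nullary.Decidable using (⌊_⌋; isYes≗does; dec-true; dec-false)

∧-true⁻ˡ : ∀ {a} b → a ∧ b ≡ true → a ≡ true
∧-true⁻ˡ {true} _ _ = refl

∧-true⁻ʳ : ∀ a {b} → a ∧ b ≡ true → b ≡ true
∧-true⁻ʳ true e = e

∧-true⁺ : ∀ {a b} → a ≡ true → b ≡ true → a ∧ b ≡ true
∧-true⁺ refl refl = refl

∨-true⁻ : ∀ a {b} → a ∨ b ≡ true → a ≡ true ⊎ b ≡ true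
∨-true⁻ true  _ = inj₁ refl
∨-true⁻ false e = inj₂ e

∨-true⁺ˡ : ∀ {a} b → a ≡ true → a ∨ b ≡ true
∨-true⁺ˡ _ refl = refl

∨-true⁺ʳ : ∀ a {b} → b ≡ true → a ∨ b ≡ true
∨-true⁺ʳ true  _ = refl
∨-true⁺ʳ false e = e

Bool-ext : ∀ {a b} → (a ≡ true → b ≡ true) → (b ≡ true → a ≡ true) → a ≡ b
Bool-ext {false} {false} _ _ = refl
Bool-ext {false} {true}  _ b⇒a = b⇒a refl
Bool-ext {true}  {_}     a⇒b _ = sym (a⇒b refl)

not-∨-true⁻ : ∀ a {b} → not (a ∨ b) ≡ true → a ≡ false × b ≡ false
not-∨-true⁻ false {false} _ = refl , refl

not-true⁻ : ∀ {a} → not a ≡ true → a ≡ false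
not-true⁻ {false} _ = refl

module _ {n : ℕ} {a b : Fin n} where

  ≟⇒≡ : ⌊ a ≟ b ⌋ ≡ true → a ≡ b
  ≟⇒≡ e with a ≟ b
  ... | yes a≡b = a≡b

  ≡⇒≟ : a ≡ b → ⌊ a ≟ b ⌋ ≡ true
  ≡⇒≟ a≡b = trans (isYes≗does (a ≟ b)) (dec-true (a ≟ b) a≡b)

  ≢⇒≟ : a ≢ b → ⌊ a ≟ b ⌋ ≡ false
  ≢⇒≟ a≢b = trans (isYes≗does (a ≟ b)) (dec-false (a ≟ b) a≢b)

≟-refl : ∀ {n} (a : Fin n) → ⌊ a ≟ a ⌋ ≡ true
≟-refl a = ≡⇒≟ refl

≟-sym : ∀ {n} (a b : Fin n) → ⌊ a ≟ b ⌋ ≡ ⌊ b ≟ a ⌋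
≟-sym a b with a ≟ b | b ≟ a
... | yes _   | yes _   = refl
... | no  _   | no  _   = refl
... | yes a≡b | no  b≢a = ⊥-elim (b≢a (sym a≡b))
... | no  a≢b | yes b≡a = ⊥-elim (a≢b (sym b≡a))

anyᶠ : ∀ {n} → (Fin n → Bool) → Bool
anyᶠ P = ⌊ any? (λ i → P i ≟ᵇ true) ⌋

anyᶠ⁺ : ∀ {n} {P : Fin n → Bool} i → P i ≡ true → anyᶠ P ≡ true
anyᶠ⁺ {P = P} i Pi = trans (isYes≗does (any? (λ i → P i ≟ᵇ true))) (dec-true (any? _) (i , Pi))

anyᶠ⁻ : ∀ {n} (P : Fin n → Bool) → anyᶠ P ≡ true → ∃[ i ] P i ≡ true
anyᶠ⁻ P h with any? (λ i → P i ≟ᵇ true)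
... | yes witness = witness

indicator : Bool → ℕ
indicator true  = 1
indicator false = 0

count : ∀ {n} → (Fin n → Bool) → ℕ
count P = sum (indicator ∘ P)

sum-mono-≤ : ∀ {n} {f g : Fin n → ℕ} → (∀ i → f i ≤ g i) → sum f ≤ sum g
sum-mono-≤ {zero}  _   = z≤n
sum-mono-≤ {suc n} f≤g = +-mono-≤ (f≤g zero) (sum-mono-≤ (f≤g ∘ suc))

sum-zero : ∀ {n} {f : Fin n → ℕ} → (∀ i → f i ≡ 0) → sum f ≡ 0
sum-zero {zero}  _    = refl
sum-zero {suc n} f≡0 = cong₂ _+_ (f≡0 zero) (sum-zero (f≡0 ∘ suc))

sum-supported-at : ∀ {n} (f : Fin n → ℕ) c → (∀ i → i ≢ c → f i ≡ 0) → sum f ≡ f c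
sum-supported-at f zero f≡0 =
  trans (cong (f zero +_) (sum-zero (λ i → f≡0 (suc i) λ ()))) (+-identityʳ _)
sum-supported-at f (suc c) f≡0 =
  cong₂ _+_ (f≡0 zero λ ()) (sum-supported-at (f ∘ suc) c (λ i i≢c → f≡0 (suc i) (i≢c ∘ fsuc-injective)))

sum-≥ : ∀ {n} (f : Fin n → ℕ) c → f c ≤ sum f
sum-≥ f zero    = m≤m+n _ _
sum-≥ f (suc c) = ≤-trans (sum-≥ (f ∘ suc) c) (m≤n+m _ _)

sum-const-1 : ∀ n → sum {n} (λ _ → 1) ≡ n
sum-const-1 zero    = refl
sum-const-1 (suc n) = cong suc (sum-const-1 n)

≰1⇒≡0 : ∀ {k} → ¬ 1 ≤ k → k ≡ 0
≰1⇒≡0 {k} ≰1 = n<1⇒n≡0 (≰⇒> ≰1)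

indicator≤1 : ∀ b → indicator b ≤ 1
indicator≤1 true  = ≤-refl
indicator≤1 false = z≤n

indicator-mono : ∀ {a b} → (a ≡ true → b ≡ true) → indicator a ≤ indicator b
indicator-mono {false} _   = z≤n
indicator-mono {true}  a⇒b rewrite a⇒b refl = ≤-refl

module _ {n : ℕ} where

  count-mono : {P Q : Fin n → Bool} → (∀ i → P i ≡ true → Q i ≡ true) → count P ≤ count Q
  count-mono P⇒Q = sum-mono-≤ (λ i → indicator-mono (P⇒Q i))

  count-cong : {P Q : Fin n → Bool} → (∀ i → P i ≡ Q i) → count P ≡ count Q
  count-cong P≡Q = sum-cong-≗ (cong indicator ∘ P≡Q)

  count-const : count {n} (λ _ → true) ≡ n
  count-const = sum-const-1 n

  count-singleton : (c : Fin n) → count (λ i → ⌊ i ≟ c ⌋) ≡ 1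
  count-singleton c =
    trans (sum-supported-at _ c (λ i i≢c → cong indicator (≢⇒≟ i≢c))) (cong indicator (≟-refl c))

  count-split : (P Q : Fin n → Bool) → count P ≡ count (λ i → P i ∧ Q i) + count (λ i → P i ∧ not (Q i))
  count-split P Q =
    trans (sum-cong-≗ (λ i → split (P i) (Q i)))
          (∑-distrib-+ (λ i → indicator (P i ∧ Q i)) (λ i → indicator (P i ∧ not (Q i))))
    where
    split : ∀ a b → indicator a ≡ indicator (a ∧ b) + indicator (a ∧ not b)
    split true  true  = refl
    split true  false = refl
    split false _     = refl

  count-complement : (P : Fin n → Bool) → count P + count (not ∘ P) ≡ n
  count-complement P = trans (sym (count-split (λ _ → true) P)) count-const

  count-insert : {P Q : Fin n → Bool} (c : Fin n) → (∀ i → P i ≡ true → Q i ≡ true) →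
                 P c ≡ false → Q c ≡ true → suc (count P) ≤ count Q
  count-insert {P} {Q} c P⇒Q Pc Qc = begin
    suc (count P)                                   ≡⟨ +-comm 1 (count P) ⟩
    count P + 1                                     ≡⟨ cong (count P +_) (count-singleton c) ⟨
    count P + count (λ i → ⌊ i ≟ c ⌋)               ≡⟨ ∑-distrib-+ (indicator ∘ P) (λ i → indicator ⌊ i ≟ c ⌋) ⟨
    sum (λ i → indicator (P i) + indicator ⌊ i ≟ c ⌋) ≤⟨ sum-mono-≤ pointwise ⟩
    count Q                                         ∎
    where
    open ≤-Reasoning
    pointwise : ∀ i → indicator (P i) + indicator ⌊ i ≟ c ⌋ ≤ indicator (Q i)
    pointwise i with i ≟ c
    ... | yes refl rewrite Pc | Qc = ≤-refl
    ... | no _ = ≤-trans (≤-reflexive (+-identityʳ _)) (indicator-mono (P⇒Q i))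

  count-remove : (P : Fin n → Bool) (c : Fin n) → P c ≡ true →
                 count P ≡ suc (count (λ i → P i ∧ not ⌊ i ≟ c ⌋))
  count-remove P c Pc =
    trans (count-split P (λ i → ⌊ i ≟ c ⌋)) (cong (_+ count (λ i → P i ∧ not ⌊ i ≟ c ⌋)) (trans (count-cong at-c) (count-singleton c)))
    where
    at-c : ∀ i → P i ∧ ⌊ i ≟ c ⌋ ≡ ⌊ i ≟ c ⌋
    at-c i with i ≟ c
    ... | yes refl = trans (∧-identityʳ (P i)) Pc
    ... | no _ = ∧-zeroʳ (P i)

  count-pos : {P : Fin n → Bool} (c : Fin n) → P c ≡ true → 1 ≤ count P
  count-pos {P} c Pc =
    ≤-trans (≤-reflexive (sym (count-singleton c))) (count-mono (λ i e → subst (λ j → P j ≡ true) (sym (≟⇒≡ e)) Pc))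

  count-two : {P : Fin n → Bool} (a b : Fin n) → a ≢ b → P a ≡ true → P b ≡ true → 2 ≤ count P
  count-two {P} a b a≢b Pa Pb =
    ≤-trans (≤-reflexive (cong suc (sym (count-singleton a))))
      (count-insert b (λ i e → subst (λ j → P j ≡ true) (sym (≟⇒≡ e)) Pa) (≢⇒≟ (a≢b ∘ sym)) Pb)

  count-≤-suc : {P Q : Fin n → Bool} (c : Fin n) → (∀ i → i ≢ c → P i ≡ true → Q i ≡ true) → count P ≤ suc (count Q)
  count-≤-suc {P} {Q} c P⇒Q = begin
    count P                                                      ≡⟨ count-split P (λ i → ⌊ i ≟ c ⌋) ⟩
    count (λ i → P i ∧ ⌊ i ≟ c ⌋) + count (λ i → P i ∧ not ⌊ i ≟ c ⌋) ≤⟨ +-mono-≤ at-c off-c ⟩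
    1 + count Q                                                  ∎
    where
    open ≤-Reasoning
    at-c : count (λ i → P i ∧ ⌊ i ≟ c ⌋) ≤ 1
    at-c = ≤-trans (count-mono (λ i → ∧-true⁻ʳ (P i))) (≤-reflexive (count-singleton c))
    off-c : count (λ i → P i ∧ not ⌊ i ≟ c ⌋) ≤ count Q
    off-c = count-mono (λ i h → P⇒Q i (λ i≡c → not-¬ (≡⇒≟ i≡c) (not-true⁻ (∧-true⁻ʳ (P i) h))) (∧-true⁻ˡ _ h))

  count≡0 : {P : Fin n → Bool} → count P ≡ 0 → ∀ i → P i ≡ false
  count≡0 {P} none i = ¬-not λ Pi → 1+n≰n (≤-trans (count-pos i Pi) (≤-reflexive none))

count-witness : ∀ {n} (P : Fin n → Bool) → 1 ≤ count P → ∃[ i ] P i ≡ true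
count-witness {suc n} P pos with P zero in P0
... | true  = zero , P0
... | false = let i , Pi = count-witness (P ∘ suc) pos in suc i , Pi

count-choose : ∀ {n} (P : Fin n → Bool) {k} → k ≤ count P →
               ∃[ Q ] (∀ i → Q i ≡ true → P i ≡ true) × count Q ≡ k
count-choose {zero} P z≤n = (λ ()) , (λ ()) , refl
count-choose {suc n} P {k} k≤ with k ≤? count (P ∘ suc)
... | yes k≤rest = let Q , Q⊆P , size = count-choose (P ∘ suc) k≤rest
                   in (λ { zero → false ; (suc i) → Q i }) , (λ { zero () ; (suc i) → Q⊆P i }) , size
... | no k≰rest with P zero in P0 | k
...   | false | _     = ⊥-elim (k≰rest k≤)
...   | true  | zero  = ⊥-elim (k≰rest z≤n)
...   | true  | suc k′ = let Q , Q⊆P , size = count-choose (P ∘ suc) (≤-pred k≤)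
                        in (λ { zero → true ; (suc i) → Q i }) , (λ { zero _ → P0 ; (suc i) → Q⊆P i }) , cong suc size

countTrue-∷ : ∀ b bs → countTrue (b ∷ bs) ≡ indicator b + countTrue bs
countTrue-∷ true  _ = refl
countTrue-∷ false _ = refl

countTrue-++ : ∀ xs ys → countTrue (xs ++ ys) ≡ countTrue xs + countTrue ys
countTrue-++ []       ys = refl
countTrue-++ (b ∷ xs) ys = begin
  countTrue (b ∷ xs ++ ys)                   ≡⟨ countTrue-∷ b (xs ++ ys) ⟩
  indicator b + countTrue (xs ++ ys)         ≡⟨ cong (indicator b +_) (countTrue-++ xs ys) ⟩
  indicator b + (countTrue xs + countTrue ys) ≡⟨ +-assoc (indicator b) _ _ ⟨
  indicator b + countTrue xs + countTrue ys  ≡⟨ cong (_+ countTrue ys) (countTrue-∷ b xs) ⟨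
  countTrue (b ∷ xs) + countTrue ys          ∎
  where open ≡-Reasoning

module _ {A : Set} (P : A → Bool) where

  count∘lookup : (xs : List A) → count (P ∘ lookup xs) ≡ countTrue (map P xs)
  count∘lookup []       = refl
  count∘lookup (x ∷ xs) = trans (cong (indicator (P x) +_) (count∘lookup xs)) (sym (countTrue-∷ (P x) (map P xs)))

  countTrue-tabulate : ∀ {n} (f : Fin n → A) → countTrue (map P (tabulate f)) ≡ count (P ∘ f)
  countTrue-tabulate {zero}  f = refl
  countTrue-tabulate {suc n} f =
    trans (countTrue-∷ (P (f zero)) _) (cong (indicator (P (f zero)) +_) (countTrue-tabulate (f ∘ suc)))

  countTrue-concatMap-tabulate : ∀ {B : Set} {n} (g : B → List A) (f : Fin n → B) →
    countTrue (map P (concatMap g (tabulate f))) ≡ sum (λ i → countTrue (map P (g (f i))))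
  countTrue-concatMap-tabulate {n = zero}  g f = refl
  countTrue-concatMap-tabulate {n = suc n} g f = begin
    countTrue (map P (g (f zero) ++ concatMap g (tabulate (f ∘ suc))))          ≡⟨ cong countTrue (map-++ P (g (f zero)) _) ⟩
    countTrue (map P (g (f zero)) ++ map P (concatMap g (tabulate (f ∘ suc)))) ≡⟨ countTrue-++ (map P (g (f zero))) _ ⟩
    countTrue (map P (g (f zero))) + countTrue (map P (concatMap g (tabulate (f ∘ suc))))
      ≡⟨ cong (countTrue (map P (g (f zero))) +_) (countTrue-concatMap-tabulate g (f ∘ suc)) ⟩
    sum (λ i → countTrue (map P (g (f i))))                                     ∎
    where open ≡-Reasoning

deg≡count : ∀ {n} (G : Graph n) c → deg G c ≡ count (adj G c)
deg≡count G c = countTrue-tabulate (adj G c) (λ i → i)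

module _ {A : Set} (f : A → ℕ) where

  foldr-⊓-≤ : ∀ {n} (g : Fin n → A) b i → foldr _⊓_ b (map f (tabulate g)) ≤ f (g i)
  foldr-⊓-≤ g b zero    = m⊓n≤m _ _
  foldr-⊓-≤ g b (suc i) = ≤-trans (m⊓n≤n _ _) (foldr-⊓-≤ (g ∘ suc) b i)

  foldr-⊓-glb : ∀ {n} (g : Fin n → A) {b a} → (∀ i → a ≤ f (g i)) → a ≤ b → a ≤ foldr _⊓_ b (map f (tabulate g))
  foldr-⊓-glb {zero}  g _   a≤b = a≤b
  foldr-⊓-glb {suc n} g a≤f a≤b = ⊓-glb (a≤f zero) (foldr-⊓-glb (g ∘ suc) (a≤f ∘ suc) a≤b)

  foldr-⊔-≥ : ∀ {n} (g : Fin n → A) i → f (g i) ≤ foldr _⊔_ 0 (map f (tabulate g))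
  foldr-⊔-≥ g zero    = m≤m⊔n _ _
  foldr-⊔-≥ g (suc i) = ≤-trans (foldr-⊔-≥ (g ∘ suc) i) (m≤n⊔m _ _)

  foldr-⊔-attained : ∀ {n} (g : Fin (suc n) → A) → ∃[ i ] foldr _⊔_ 0 (map f (tabulate g)) ≤ f (g i)
  foldr-⊔-attained {zero}  g = zero , ≤-reflexive (⊔-identityʳ _)
  foldr-⊔-attained {suc n} g with foldr-⊔-attained (g ∘ suc)
  ... | i , max≤ with f (g zero) ≤? f (g (suc i))
  ...   | yes ≤i = suc i , ⊔-lub ≤i max≤
  ...   | no  ≰i = zero , ⊔-lub ≤-refl (≤-trans max≤ (<⇒≤ (≰⇒> ≰i)))

minDeg≤deg : ∀ {n} (G : Graph n) x → minDeg G ≤ deg G x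
minDeg≤deg {suc n} G = foldr-⊓-≤ (deg G) (λ i → i) (deg G zero)

deg≤maxDeg : ∀ {n} (G : Graph n) x → deg G x ≤ maxDeg G
deg≤maxDeg G = foldr-⊔-≥ (deg G) (λ i → i)

maxDeg-attained : ∀ {n} (G : Graph (suc n)) → ∃[ x ] maxDeg G ≤ deg G x
maxDeg-attained G = foldr-⊔-attained (deg G) (λ i → i)

minDeg-glb : ∀ {n} (G : Graph (suc n)) {d} → (∀ x → d ≤ deg G x) → d ≤ minDeg G
minDeg-glb G d≤deg = foldr-⊓-glb (deg G) (λ i → i) d≤deg (d≤deg zero)

-- Edges of a simple graph

<ᵇ-true : ∀ {m n} → m < n → (m <ᵇ n) ≡ true
<ᵇ-true = Equivalence.to T-≡ ∘ <⇒<ᵇ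

<ᵇ-false : ∀ {m n} → ¬ m < n → (m <ᵇ n) ≡ false
<ᵇ-false {m} {n} m≮n = ¬-not (m≮n ∘ <ᵇ⇒< m n ∘ Equivalence.from T-≡)

module _ {n : ℕ} where

  endpoint : Fin n → Fin n × Fin n → Bool
  endpoint x (p , q) = ⌊ p ≟ x ⌋ ∨ ⌊ q ≟ x ⌋

  _∈ₑ_ : Fin n → Fin n × Fin n → Set
  x ∈ₑ e = endpoint x e ≡ true

  anyEnd : (Fin n → Bool) → Fin n × Fin n → Bool
  anyEnd Y (p , q) = Y p ∨ Y q

  proj₁∈ₑ : ∀ e → proj₁ e ∈ₑ e
  proj₁∈ₑ e = ∨-true⁺ˡ _ (≟-refl (proj₁ e))

  proj₂∈ₑ : ∀ e → proj₂ e ∈ₑ e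
  proj₂∈ₑ e = ∨-true⁺ʳ _ (≟-refl (proj₂ e))

  ∈ₑ⁻ : ∀ {x} e → x ∈ₑ e → proj₁ e ≡ x ⊎ proj₂ e ≡ x
  ∈ₑ⁻ (p , q) x∈e with ∨-true⁻ ⌊ p ≟ _ ⌋ x∈e
  ... | inj₁ p≡x = inj₁ (≟⇒≡ p≡x)
  ... | inj₂ q≡x = inj₂ (≟⇒≡ q≡x)

  ∈ₑ-pair : ∀ {a b} e → a ≢ b → a ∈ₑ e → b ∈ₑ e → e ≡ (a , b) ⊎ e ≡ (b , a)
  ∈ₑ-pair e a≢b a∈e b∈e with ∈ₑ⁻ e a∈e | ∈ₑ⁻ e b∈e
  ... | inj₁ refl | inj₁ refl = ⊥-elim (a≢b refl)
  ... | inj₁ refl | inj₂ refl = inj₁ refl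
  ... | inj₂ refl | inj₁ refl = inj₂ refl
  ... | inj₂ refl | inj₂ refl = ⊥-elim (a≢b refl)

  ∈ₑ-third : ∀ {a b t} e → a ≢ b → a ∈ₑ e → b ∈ₑ e → t ∈ₑ e → t ≡ a ⊎ t ≡ b
  ∈ₑ-third e a≢b a∈e b∈e t∈e with ∈ₑ-pair e a≢b a∈e b∈e | ∈ₑ⁻ e t∈e
  ... | inj₁ refl | inj₁ refl = inj₁ refl
  ... | inj₁ refl | inj₂ refl = inj₂ refl
  ... | inj₂ refl | inj₁ refl = inj₂ refl
  ... | inj₂ refl | inj₂ refl = inj₁ refl

  anyEnd⁺ : ∀ Y {x} e → x ∈ₑ e → Y x ≡ true → anyEnd Y e ≡ true
  anyEnd⁺ Y e x∈e Yx with ∈ₑ⁻ e x∈e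
  ... | inj₁ refl = ∨-true⁺ˡ _ Yx
  ... | inj₂ refl = ∨-true⁺ʳ _ Yx

  anyEnd⁻ : ∀ Y e → anyEnd Y e ≡ true → ∃[ x ] x ∈ₑ e × Y x ≡ true
  anyEnd⁻ Y e h with ∨-true⁻ (Y (proj₁ e)) h
  ... | inj₁ Yp = proj₁ e , proj₁∈ₑ e , Yp
  ... | inj₂ Yq = proj₂ e , proj₂∈ₑ e , Yq

  shareEnd⁺ : ∀ {s} e f → s ∈ₑ e → s ∈ₑ f → shareEnd e f ≡ true
  shareEnd⁺ e@(a , b) f@(c , d) s∈e s∈f with ∈ₑ⁻ e s∈e | ∈ₑ⁻ f s∈f
  ... | inj₁ refl | inj₁ refl = ∨-true⁺ˡ _ (≟-refl a)
  ... | inj₁ refl | inj₂ refl = ∨-true⁺ʳ ⌊ a ≟ c ⌋ (∨-true⁺ˡ _ (≟-refl a))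
  ... | inj₂ refl | inj₁ refl = ∨-true⁺ʳ ⌊ a ≟ c ⌋ (∨-true⁺ʳ ⌊ a ≟ d ⌋ (∨-true⁺ˡ _ (≟-refl b)))
  ... | inj₂ refl | inj₂ refl = ∨-true⁺ʳ ⌊ a ≟ c ⌋ (∨-true⁺ʳ ⌊ a ≟ d ⌋ (∨-true⁺ʳ ⌊ b ≟ c ⌋ (≟-refl b)))

  shareEnd⁻ : ∀ e f → shareEnd e f ≡ true → ∃[ s ] s ∈ₑ e × s ∈ₑ f
  shareEnd⁻ e@(a , b) f@(c , d) h with ∨-true⁻ ⌊ a ≟ c ⌋ h
  ... | inj₁ a≟c = a , proj₁∈ₑ e , subst (_∈ₑ f) (sym (≟⇒≡ a≟c)) (proj₁∈ₑ f)
  ... | inj₂ h with ∨-true⁻ ⌊ a ≟ d ⌋ h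
  ...   | inj₁ a≟d = a , proj₁∈ₑ e , subst (_∈ₑ f) (sym (≟⇒≡ a≟d)) (proj₂∈ₑ f)
  ...   | inj₂ h with ∨-true⁻ ⌊ b ≟ c ⌋ h
  ...     | inj₁ b≟c = b , proj₂∈ₑ e , subst (_∈ₑ f) (sym (≟⇒≡ b≟c)) (proj₁∈ₑ f)
  ...     | inj₂ b≟d = b , proj₂∈ₑ e , subst (_∈ₑ f) (sym (≟⇒≡ b≟d)) (proj₂∈ₑ f)

module Edges {n : ℕ} (G : Graph n) (simple : Simple G) where

  adj-sym : ∀ a b → adj G a b ≡ adj G b a
  adj-sym = proj₁ simple

  adj-irrefl : ∀ a → adj G a a ≡ false
  adj-irrefl = proj₂ simple

  Adj⇒≢ : ∀ {a b} → Adj G a b → a ≢ b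
  Adj⇒≢ {a} h refl = not-¬ h (adj-irrefl a)

  ascending : Fin n → Fin n → Bool
  ascending i j = (toℕ i <ᵇ toℕ j) ∧ adj G i j

  ends : Fin (numEdges G) → Fin n × Fin n
  ends = lookup (edges G)

  -- Every fact about the edge list used below is read off from this formula.
  count-edges : (P : Fin n × Fin n → Bool) →
                count (P ∘ ends) ≡ sum (λ i → count (λ j → ascending i j ∧ P (i , j)))
  count-edges P = begin
    count (P ∘ ends)                                 ≡⟨ count∘lookup P (edges G) ⟩
    countTrue (map P (edges G))                      ≡⟨ countTrue-concatMap-tabulate P row (λ i → i) ⟩
    sum (λ i → countTrue (map P (row i)))            ≡⟨ sum-cong-≗ (λ i → countTrue-concatMap-tabulate P (single i) (λ j → j)) ⟩
    sum (λ i → sum (λ j → countTrue (map P (single i j)))) ≡⟨ sum-cong-≗ (λ i → sum-cong-≗ (single-count i)) ⟩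
    sum (λ i → count (λ j → ascending i j ∧ P (i , j))) ∎
    where
    open ≡-Reasoning
    single : Fin n → Fin n → List (Fin n × Fin n)
    single i j = if ascending i j then (i , j) ∷ [] else []
    row : Fin n → List (Fin n × Fin n)
    row i = concatMap (single i) (tabulate (λ j → j))
    single-count : ∀ i j → countTrue (map P (single i j)) ≡ indicator (ascending i j ∧ P (i , j))
    single-count i j with ascending i j
    ... | true  = trans (countTrue-∷ (P (i , j)) []) (+-identityʳ _)
    ... | false = refl

  ascending-irrefl : ∀ i → ascending i i ≡ false
  ascending-irrefl i rewrite <ᵇ-false (n≮n (toℕ i)) = refl

  ends-ascending : ∀ e → ascending (proj₁ (ends e)) (proj₂ (ends e)) ≡ true
  ends-ascending e = not-injective (count≡0 no-descending e)
    where
    no-descending : count (λ e → not (ascending (proj₁ (ends e)) (proj₂ (ends e)))) ≡ 0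
    no-descending = trans (count-edges (λ p → not (ascending (proj₁ p) (proj₂ p))))
                          (sum-zero (λ i → sum-zero (λ j → cong indicator (∧-inverseʳ (ascending i j)))))

  ends-< : ∀ e → toℕ (proj₁ (ends e)) < toℕ (proj₂ (ends e))
  ends-< e = <ᵇ⇒< _ _ (Equivalence.from T-≡ (∧-true⁻ˡ _ (ends-ascending e)))

  ends-adj : ∀ e → Adj G (proj₁ (ends e)) (proj₂ (ends e))
  ends-adj e = ∧-true⁻ʳ (toℕ (proj₁ (ends e)) <ᵇ toℕ (proj₂ (ends e))) (ends-ascending e)

  ends-distinct : ∀ e → proj₁ (ends e) ≢ proj₂ (ends e)
  ends-distinct e = Adj⇒≢ (ends-adj e)

  other-end : ∀ {a} e → a ∈ₑ ends e → ∃[ o ] o ∈ₑ ends e × o ≢ a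
  other-end e a∈e with ∈ₑ⁻ (ends e) a∈e
  ... | inj₁ refl = proj₂ (ends e) , proj₂∈ₑ (ends e) , ends-distinct e ∘ sym
  ... | inj₂ refl = proj₁ (ends e) , proj₁∈ₑ (ends e) , ends-distinct e

  hasEnds : Fin n → Fin n → Fin n × Fin n → Bool
  hasEnds a b (p , q) = ⌊ p ≟ a ⌋ ∧ ⌊ q ≟ b ⌋

  count-hasEnds≤1 : ∀ a b → count (hasEnds a b ∘ ends) ≤ 1
  count-hasEnds≤1 a b = begin
    count (hasEnds a b ∘ ends)                                   ≡⟨ count-edges (hasEnds a b) ⟩
    sum (λ i → count (λ j → ascending i j ∧ (⌊ i ≟ a ⌋ ∧ ⌊ j ≟ b ⌋))) ≤⟨ sum-mono-≤ row≤ ⟩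
    count (λ i → ⌊ i ≟ a ⌋)                                      ≡⟨ count-singleton a ⟩
    1                                                            ∎
    where
    open ≤-Reasoning
    row≤ : ∀ i → count (λ j → ascending i j ∧ (⌊ i ≟ a ⌋ ∧ ⌊ j ≟ b ⌋)) ≤ indicator ⌊ i ≟ a ⌋
    row≤ i with i ≟ a
    ... | yes _ = ≤-trans (count-mono (λ j → ∧-true⁻ʳ (ascending i j))) (≤-reflexive (count-singleton b))
    ... | no  _ = ≤-reflexive (sum-zero (λ j → cong indicator (∧-zeroʳ (ascending i j))))

  ends-injective : ∀ e f → ends e ≡ ends f → e ≡ f
  ends-injective e f ends≡ with e ≟ f
  ... | yes e≡f = e≡f
  ... | no  e≢f = ⊥-elim (1+n≰n (≤-trans (count-two e f e≢f at-e at-f) (count-hasEnds≤1 a b)))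
    where
    a b : Fin n
    a = proj₁ (ends e)
    b = proj₂ (ends e)
    at-e : hasEnds a b (ends e) ≡ true
    at-e = ∧-true⁺ (≟-refl a) (≟-refl b)
    at-f : hasEnds a b (ends f) ≡ true
    at-f = subst (λ p → hasEnds a b p ≡ true) ends≡ at-e

  ascending⇒edge : ∀ {a b} → ascending a b ≡ true → ∃[ e ] ends e ≡ (a , b)
  ascending⇒edge {a} {b} asc with count-witness (hasEnds a b ∘ ends) present
    where
    present : 1 ≤ count (hasEnds a b ∘ ends)
    present = begin
      1
        ≤⟨ count-pos b (∧-true⁺ asc (∧-true⁺ (≟-refl a) (≟-refl b))) ⟩
      count (λ j → ascending a j ∧ (⌊ a ≟ a ⌋ ∧ ⌊ j ≟ b ⌋))
        ≤⟨ sum-≥ (λ i → count (λ j → ascending i j ∧ (⌊ i ≟ a ⌋ ∧ ⌊ j ≟ b ⌋))) a ⟩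
      sum (λ i → count (λ j → ascending i j ∧ (⌊ i ≟ a ⌋ ∧ ⌊ j ≟ b ⌋)))
        ≡⟨ count-edges (hasEnds a b) ⟨
      count (hasEnds a b ∘ ends)
        ∎
      where open ≤-Reasoning
  ... | e , has = e , cong₂ _,_ (≟⇒≡ (∧-true⁻ˡ _ has)) (≟⇒≡ (∧-true⁻ʳ _ has))

  edge-joining : ∀ {a b} → Adj G a b → ∃[ e ] a ∈ₑ ends e × b ∈ₑ ends e
  edge-joining {a} {b} a~b with <-cmp (toℕ a) (toℕ b)
  ... | tri< a<b _ _ = let e , ends≡ = ascending⇒edge (∧-true⁺ (<ᵇ-true a<b) a~b) in
    e , subst (a ∈ₑ_) (sym ends≡) (proj₁∈ₑ (a , b)) , subst (b ∈ₑ_) (sym ends≡) (proj₂∈ₑ (a , b))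
  ... | tri> _ _ b<a = let e , ends≡ = ascending⇒edge (∧-true⁺ (<ᵇ-true b<a) (trans (adj-sym b a) a~b)) in
    e , subst (a ∈ₑ_) (sym ends≡) (proj₂∈ₑ (b , a)) , subst (b ∈ₑ_) (sym ends≡) (proj₁∈ₑ (b , a))
  ... | tri≈ _ a≡b _ = ⊥-elim (Adj⇒≢ a~b (toℕ-injective a≡b))

  ends≡⇒< : ∀ e {p q} → ends e ≡ (p , q) → toℕ p < toℕ q
  ends≡⇒< e ends≡ = subst (λ r → toℕ (proj₁ r) < toℕ (proj₂ r)) ends≡ (ends-< e)

  edge-determined : ∀ {a b} e f → a ≢ b → a ∈ₑ ends e → b ∈ₑ ends e → a ∈ₑ ends f → b ∈ₑ ends f → e ≡ f
  edge-determined e f a≢b a∈e b∈e a∈f b∈f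
    with ∈ₑ-pair (ends e) a≢b a∈e b∈e | ∈ₑ-pair (ends f) a≢b a∈f b∈f
  ... | inj₁ e≡ | inj₁ f≡ = ends-injective e f (trans e≡ (sym f≡))
  ... | inj₂ e≡ | inj₂ f≡ = ends-injective e f (trans e≡ (sym f≡))
  ... | inj₁ e≡ | inj₂ f≡ = ⊥-elim (<-asym (ends≡⇒< e e≡) (ends≡⇒< f f≡))
  ... | inj₂ e≡ | inj₁ f≡ = ⊥-elim (<-asym (ends≡⇒< e e≡) (ends≡⇒< f f≡))

  ascending-either : ∀ a b y → indicator (ascending a b ∧ y) + indicator (ascending b a ∧ y) ≡ indicator (adj G a b ∧ y)
  ascending-either a b y with <-cmp (toℕ a) (toℕ b)
  ... | tri< a<b _ b≮a rewrite <ᵇ-true a<b | <ᵇ-false b≮a = +-identityʳ _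
  ... | tri> a≮b _ b<a rewrite <ᵇ-false a≮b | <ᵇ-true b<a | adj-sym b a = refl
  ... | tri≈ _ a≡b _ rewrite toℕ-injective a≡b | ascending-irrefl b | adj-irrefl b = refl

  joins : Fin n → (Fin n → Bool) → Fin n × Fin n → Bool
  joins c Y p = endpoint c p ∧ anyEnd Y p

  count-joins : ∀ c Y → Y c ≡ false → count (joins c Y ∘ ends) ≡ count (λ x → adj G c x ∧ Y x)
  count-joins c Y Yc = begin
    count (joins c Y ∘ ends)
      ≡⟨ count-edges (joins c Y) ⟩
    sum (λ i → count (λ j → ascending i j ∧ joins c Y (i , j)))
      ≡⟨ sum-cong-≗ (λ i → trans (sum-cong-≗ (split i)) (∑-distrib-+ (indicator ∘ leaving i) (indicator ∘ entering i))) ⟩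
    sum (λ i → count (leaving i) + count (entering i))
      ≡⟨ ∑-distrib-+ (λ i → count (leaving i)) (λ i → count (entering i)) ⟩
    sum (λ i → count (leaving i)) + sum (λ i → count (entering i))
      ≡⟨ cong₂ _+_ out-of-c into-c ⟩
    count (λ x → ascending c x ∧ Y x) + count (λ x → ascending x c ∧ Y x)
      ≡⟨ ∑-distrib-+ (λ x → indicator (ascending c x ∧ Y x)) (λ x → indicator (ascending x c ∧ Y x)) ⟨
    sum (λ x → indicator (ascending c x ∧ Y x) + indicator (ascending x c ∧ Y x))
      ≡⟨ sum-cong-≗ (λ x → ascending-either c x (Y x)) ⟩
    count (λ x → adj G c x ∧ Y x)
      ∎
    where
    open ≡-Reasoning
    leaving entering : Fin n → Fin n → Bool
    leaving  i j = ⌊ i ≟ c ⌋ ∧ (ascending i j ∧ Y j)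
    entering i j = ⌊ j ≟ c ⌋ ∧ (ascending i j ∧ Y i)
    split : ∀ i j → indicator (ascending i j ∧ joins c Y (i , j)) ≡ indicator (leaving i j) + indicator (entering i j)
    split i j with i ≟ c | j ≟ c
    ... | yes refl | yes refl rewrite ascending-irrefl i = refl
    ... | yes refl | no _ rewrite Yc = sym (+-identityʳ _)
    ... | no _ | yes refl rewrite Yc | ∨-identityʳ (Y i) = refl
    ... | no _ | no _ rewrite ∧-zeroʳ (ascending i j) = refl
    out-of-c : sum (λ i → count (leaving i)) ≡ count (λ x → ascending c x ∧ Y x)
    out-of-c = trans (sum-supported-at (λ i → count (leaving i)) c
                       (λ i i≢c → sum-zero (λ j → cong (λ b → indicator (b ∧ (ascending i j ∧ Y j))) (≢⇒≟ i≢c))))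
                     (count-cong (λ j → cong (_∧ (ascending c j ∧ Y j)) (≟-refl c)))
    into-c : sum (λ i → count (entering i)) ≡ count (λ x → ascending x c ∧ Y x)
    into-c = sum-cong-≗ (λ i →
      trans (sum-supported-at (indicator ∘ entering i) c (λ j j≢c → cong (λ b → indicator (b ∧ (ascending i j ∧ Y i))) (≢⇒≟ j≢c)))
            (cong (λ b → indicator (b ∧ (ascending i c ∧ Y i))) (≟-refl c)))

-- Zero forcing

module _ {m : ℕ} where

  ∈⇒lookup : ∀ {B : Subset m} {x} → x ∈ B → Vec.lookup B x ≡ true
  ∈⇒lookup = Vec.[]=⇒lookup

  lookup⇒∈ : ∀ {B : Subset m} {x} → Vec.lookup B x ≡ true → x ∈ B
  lookup⇒∈ {B} {x} = Vec.lookup⇒[]= x B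

  ∉⇒lookup : ∀ {B : Subset m} {x} → x ∉ B → Vec.lookup B x ≡ false
  ∉⇒lookup x∉B = ¬-not (x∉B ∘ lookup⇒∈)


∣∣≡count : ∀ {m} (B : Subset m) → ∣ B ∣ ≡ count (Vec.lookup B)
∣∣≡count Vec.[]          = refl
∣∣≡count (true  Vec.∷ B) = cong suc (∣∣≡count B)
∣∣≡count (false Vec.∷ B) = ∣∣≡count B

lookup-⁅⁆ : ∀ {m} (w x : Fin m) → Vec.lookup ⁅ w ⁆ x ≡ ⌊ x ≟ w ⌋
lookup-⁅⁆ zero    zero    = refl
lookup-⁅⁆ zero    (suc x) = Vec.lookup-replicate x false
lookup-⁅⁆ (suc w) zero    = refl
lookup-⁅⁆ (suc w) (suc x) with x ≟ w | lookup-⁅⁆ w x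
... | yes _ | eq = eq
... | no  _ | eq = eq

lookup-∪⁅⁆ : ∀ {m} (B : Subset m) w x → Vec.lookup (B ∪ ⁅ w ⁆) x ≡ Vec.lookup B x ∨ ⌊ x ≟ w ⌋
lookup-∪⁅⁆ B w x = trans (Vec.lookup-zipWith _∨_ x B ⁅ w ⁆) (cong (Vec.lookup B x ∨_) (lookup-⁅⁆ w x))

lookup-∪⁅⁆-≢ : ∀ {m} (B : Subset m) {w x} → x ≢ w → Vec.lookup (B ∪ ⁅ w ⁆) x ≡ Vec.lookup B x
lookup-∪⁅⁆-≢ B {w} {x} x≢w = trans (lookup-∪⁅⁆ B w x) (trans (cong (Vec.lookup B x ∨_) (≢⇒≟ x≢w)) (∨-identityʳ _))

module ZeroForcing {m : ℕ} (H : Graph m) where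

  whiteNeighbour : Subset m → Fin m → Fin m → Bool
  whiteNeighbour B v x = adj H v x ∧ not (Vec.lookup B x)

  active : Subset m → Fin m → Bool
  active B v = Vec.lookup B v ∧ anyᶠ (whiteNeighbour B v)

  #active≤∣∣ : ∀ B → count (active B) ≤ ∣ B ∣
  #active≤∣∣ B = ≤-trans (count-mono {P = active B} (λ v → ∧-true⁻ˡ _)) (≤-reflexive (sym (∣∣≡count B)))

  #active-antitone : ∀ {B B′} → Force H B B′ → count (active B′) ≤ count (active B)
  #active-antitone {B} (force u w u∈B w∉B u~w others) = +-cancelʳ-≤ 1 _ _ (begin
    count (active B′) + 1                          ≡⟨ cong (count (active B′) +_) (count-singleton u) ⟨
    count (active B′) + count (λ v → ⌊ v ≟ u ⌋)
      ≡⟨ ∑-distrib-+ (indicator ∘ active B′) (λ v → indicator ⌊ v ≟ u ⌋) ⟨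
    sum (λ v → indicator (active B′ v) + indicator ⌊ v ≟ u ⌋) ≤⟨ sum-mono-≤ pointwise ⟩
    sum (λ v → indicator (active B v) + indicator ⌊ v ≟ w ⌋)
      ≡⟨ ∑-distrib-+ (indicator ∘ active B) (λ v → indicator ⌊ v ≟ w ⌋) ⟩
    count (active B) + count (λ v → ⌊ v ≟ w ⌋)     ≡⟨ cong (count (active B) +_) (count-singleton w) ⟩
    count (active B) + 1                           ∎)
    where
    open ≤-Reasoning
    B′ : Subset m
    B′ = B ∪ ⁅ w ⁆
    whiteNeighbour-mono : ∀ v x → whiteNeighbour B′ v x ≡ true → whiteNeighbour B v x ≡ true
    whiteNeighbour-mono v x h with x ≟ w
    ... | yes refl = ∧-true⁺ (∧-true⁻ˡ _ h) (cong not (∉⇒lookup w∉B))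
    ... | no x≢w   = subst (λ b → adj H v x ∧ not b ≡ true) (lookup-∪⁅⁆-≢ B x≢w) h
    u-sees-no-white : ∀ x → whiteNeighbour B′ u x ≡ false
    u-sees-no-white x with x ≟ w
    ... | yes refl = trans (cong (λ b → adj H u x ∧ not b) (trans (lookup-∪⁅⁆ B w w) (∨-true⁺ʳ _ (≟-refl w)))) (∧-zeroʳ _)
    ... | no x≢w   = ¬-not λ h → not-¬ (trans (lookup-∪⁅⁆-≢ B x≢w) (∈⇒lookup (others x (∧-true⁻ˡ _ h) x≢w)))
                                        (not-true⁻ (∧-true⁻ʳ (adj H u x) h))
    u-active : active B u ≡ true
    u-active = ∧-true⁺ (∈⇒lookup u∈B) (anyᶠ⁺ w (∧-true⁺ u~w (cong not (∉⇒lookup w∉B))))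
    u-inactive : active B′ u ≡ false
    u-inactive = ¬-not λ h → let x , x-white = anyᶠ⁻ (whiteNeighbour B′ u) (∧-true⁻ʳ (Vec.lookup B′ u) h)
                             in not-¬ x-white (u-sees-no-white x)
    shrinks : ∀ v → v ≢ w → active B′ v ≡ true → active B v ≡ true
    shrinks v v≢w h =
      let x , x-white = anyᶠ⁻ (whiteNeighbour B′ v) (∧-true⁻ʳ (Vec.lookup B′ v) h)
      in ∧-true⁺ (trans (sym (lookup-∪⁅⁆-≢ B v≢w)) (∧-true⁻ˡ _ h)) (anyᶠ⁺ x (whiteNeighbour-mono v x x-white))
    pointwise : ∀ v → indicator (active B′ v) + indicator ⌊ v ≟ u ⌋ ≤ indicator (active B v) + indicator ⌊ v ≟ w ⌋
    pointwise v with v ≟ w | v ≟ u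
    ... | yes refl | yes refl = ⊥-elim (w∉B u∈B)
    ... | yes refl | no _ = ≤-trans (≤-reflexive (+-identityʳ _)) (≤-trans (indicator≤1 _) (m≤n+m 1 _))
    ... | no _ | yes refl rewrite u-inactive | u-active = ≤-refl
    ... | no v≢w | no _ = +-monoˡ-≤ 0 (indicator-mono (shrinks v v≢w))

  ∁⁅⁆-isZeroForcing : ∀ {u w} → u ≢ w → Adj H u w → IsZeroForcingSet H (∁ ⁅ w ⁆)
  ∁⁅⁆-isZeroForcing {u} {w} u≢w u~w =
    ∁ ⁅ w ⁆ ∪ ⁅ w ⁆ , force u w (other-black u u≢w) (x∈p⇒x∉∁p (x∈⁅x⁆ w)) u~w (λ x _ → other-black x) ◅ ε , all-black
    where
    other-black : ∀ x → x ≢ w → x ∈ ∁ ⁅ w ⁆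
    other-black x x≢w = x∉p⇒x∈∁p (x≢w ∘ x∈⁅y⁆⇒x≡y w)
    all-black : ∀ v → v ∈ ∁ ⁅ w ⁆ ∪ ⁅ w ⁆
    all-black v with v ≟ w
    ... | yes refl = x∈p∪q⁺ (inj₂ (x∈⁅x⁆ w))
    ... | no v≢w   = x∈p∪q⁺ (inj₁ (other-black v v≢w))

  ∣∁⁅⁆∣ : ∀ w → ∣ ∁ ⁅ w ⁆ ∣ ≡ m ∸ 1
  ∣∁⁅⁆∣ w = trans (∣∁p∣≡n∸∣p∣ ⁅ w ⁆) (cong (m ∸_) (∣⁅x⁆∣≡1 w))

  module Clique (K : Fin m → Bool) (clique : ∀ a b → K a ≡ true → K b ≡ true → a ≢ b → Adj H a b) where

    whiteInK : Subset m → Fin m → Bool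
    whiteInK B v = K v ∧ not (Vec.lookup B v)

    black-in-K-active : ∀ B z → whiteInK B z ≡ true → count (λ v → K v ∧ Vec.lookup B v) ≤ count (active B)
    black-in-K-active B z z-white = count-mono λ v h →
      let v-black = ∧-true⁻ʳ (K v) h
          v≢z : v ≢ z
          v≢z v≡z = not-¬ v-black (not-true⁻ (∧-true⁻ʳ (K v) (subst (λ x → whiteInK B x ≡ true) (sym v≡z) z-white)))
      in ∧-true⁺ v-black (anyᶠ⁺ z (∧-true⁺ (clique v z (∧-true⁻ˡ _ h) (∧-true⁻ˡ _ z-white) v≢z) (∧-true⁻ʳ (K z) z-white)))

    K≤1+#active : ∀ {B T} → Star (Force H) B T → (∀ v → v ∈ T) → 1 ≤ count (whiteInK B) → count K ≤ suc (count (active B))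
    K≤1+#active {B} ε all-black white = ⊥-elim (1+n≰n (≤-trans white (≤-reflexive no-white)))
      where
      no-white : count (whiteInK B) ≡ 0
      no-white = sum-zero λ v → trans (cong (λ b → indicator (K v ∧ not b)) (∈⇒lookup (all-black v)))
                                       (cong indicator (∧-zeroʳ (K v)))
    K≤1+#active {B} (step@(force u w _ _ _ _) ◅ rest) all-black white with count (whiteInK B) ≤? 1
    ... | yes ≤1 = let z , z-white = count-witness (whiteInK B) white in begin
      count K                                                       ≡⟨ count-split K (Vec.lookup B) ⟩
      count (λ v → K v ∧ Vec.lookup B v) + count (whiteInK B)       ≤⟨ +-mono-≤ (black-in-K-active B z z-white) ≤1 ⟩
      count (active B) + 1                                          ≡⟨ +-comm _ 1 ⟩
      suc (count (active B))                                        ∎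
      where open ≤-Reasoning
    ... | no ≰1 = ≤-trans (K≤1+#active rest all-black still-white) (s≤s (#active-antitone step))
      where
      still-white : 1 ≤ count (whiteInK (B ∪ ⁅ w ⁆))
      still-white = ≤-pred (≤-trans (≰⇒> ≰1) (count-≤-suc w λ v v≢w h →
        subst (λ b → K v ∧ not b ≡ true) (sym (lookup-∪⁅⁆-≢ B v≢w)) h))

    clique-bound : ∀ S → IsZeroForcingSet H S → count K ∸ 1 ≤ ∣ S ∣
    clique-bound S (T , chain , all-black) with 1 ≤? count (whiteInK S)
    ... | yes white = ≤-trans (∸-monoˡ-≤ 1 (K≤1+#active chain all-black white)) (#active≤∣∣ S)
    ... | no  ≰1 = ≤-trans (m∸n≤m _ 1) (begin
      count K                                                       ≡⟨ count-split K (Vec.lookup S) ⟩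
      count (λ v → K v ∧ Vec.lookup S v) + count (whiteInK S)
        ≡⟨ cong (count (λ v → K v ∧ Vec.lookup S v) +_) (≰1⇒≡0 ≰1) ⟩
      count (λ v → K v ∧ Vec.lookup S v) + 0                        ≤⟨ +-monoˡ-≤ 0 (count-mono (λ v → ∧-true⁻ʳ (K v))) ⟩
      count (Vec.lookup S) + 0                                      ≡⟨ +-identityʳ _ ⟩
      count (Vec.lookup S)                                          ≡⟨ ∣∣≡count S ⟨
      ∣ S ∣                                                         ∎)
      where open ≤-Reasoning

-- Zero forcing in line graphs

module LineGraph {n : ℕ} (G : Graph n) (simple : Simple G) where

  open Edges G simple public

  L : Graph (numEdges G)
  L = lineGraph G

  L-adj⁺ : ∀ {e f s} → e ≢ f → s ∈ₑ ends e → s ∈ₑ ends f → Adj L e f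
  L-adj⁺ {e} {f} e≢f s∈e s∈f = ∧-true⁺ (cong not (≢⇒≟ e≢f)) (shareEnd⁺ (ends e) (ends f) s∈e s∈f)

  L-adj⁻ : ∀ {e f} → Adj L e f → e ≢ f × ∃[ s ] s ∈ₑ ends e × s ∈ₑ ends f
  L-adj⁻ {e} {f} e~f = (λ e≡f → not-¬ (≡⇒≟ e≡f) (not-true⁻ (∧-true⁻ˡ _ e~f)))
                     , shareEnd⁻ (ends e) (ends f) (∧-true⁻ʳ (not ⌊ e ≟ f ⌋) e~f)

  incident : Fin n → Fin (numEdges G) → Bool
  incident c e = endpoint c (ends e)

  incident-clique : ∀ c e f → incident c e ≡ true → incident c f ≡ true → e ≢ f → Adj L e f
  incident-clique c e f c∈e c∈f e≢f = L-adj⁺ e≢f c∈e c∈f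

  edges-at-common-vertex : ∀ {c a b} → Adj G c a → Adj G c b → a ≢ b → ∃[ e ] ∃[ f ] e ≢ f × Adj L e f
  edges-at-common-vertex {c} {a} {b} c~a c~b a≢b with edge-joining c~a | edge-joining c~b
  ... | e , c∈e , a∈e | f , c∈f , b∈f = e , f , e≢f , L-adj⁺ e≢f c∈e c∈f
    where
    e≢f : e ≢ f
    e≢f refl with ∈ₑ-third (ends e) (Adj⇒≢ c~a) c∈e a∈e b∈f
    ... | inj₁ b≡c = Adj⇒≢ c~b (sym b≡c)
    ... | inj₂ b≡a = a≢b (sym b≡a)

  count-incident : ∀ c → count (incident c) ≡ deg G c
  count-incident c = begin
    count (incident c)                               ≡⟨ count-cong incident-joins ⟩
    count (joins c (λ x → not ⌊ x ≟ c ⌋) ∘ ends)      ≡⟨ count-joins c _ (cong not (≟-refl c)) ⟩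
    count (λ x → adj G c x ∧ not ⌊ x ≟ c ⌋)           ≡⟨ count-cong neighbour≢c ⟩
    count (adj G c)                                  ≡⟨ deg≡count G c ⟨
    deg G c                                          ∎
    where
    open ≡-Reasoning
    incident-joins : ∀ e → incident c e ≡ joins c (λ x → not ⌊ x ≟ c ⌋) (ends e)
    incident-joins e with incident c e in c∈e
    ... | true  = let o , o∈e , o≢c = other-end e c∈e
                  in sym (anyEnd⁺ (λ x → not ⌊ x ≟ c ⌋) (ends e) o∈e (cong not (≢⇒≟ o≢c)))
    ... | false = refl
    neighbour≢c : ∀ x → adj G c x ∧ not ⌊ x ≟ c ⌋ ≡ adj G c x
    neighbour≢c x with x ≟ c
    ... | yes refl = trans (∧-zeroʳ _) (sym (adj-irrefl x))
    ... | no  _    = ∧-identityʳ _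

  incident-bound : ∀ c S → IsZeroForcingSet L S → deg G c ∸ 1 ≤ ∣ S ∣
  incident-bound c S zf = subst (λ d → d ∸ 1 ≤ ∣ S ∣) (count-incident c)
    (ZeroForcing.Clique.clique-bound L (incident c) (incident-clique c) S zf)

module Spokes {n : ℕ} (G : Graph n) (simple : Simple G) (c : Fin n) where

  open LineGraph G simple

  spokes : (Fin n → Bool) → Fin (numEdges G) → Bool
  spokes Y e = joins c Y (ends e)

  blackOffSpokes : (Fin n → Bool) → Subset (numEdges G)
  blackOffSpokes Y = Vec.tabulate (not ∘ spokes Y)

  lookup-blackOffSpokes : ∀ Y e → Vec.lookup (blackOffSpokes Y) e ≡ not (spokes Y e)
  lookup-blackOffSpokes Y = Vec.lookup∘tabulate (not ∘ spokes Y)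

  ∣blackOffSpokes∣ : ∀ Y → Y c ≡ false → ∣ blackOffSpokes Y ∣ ≡ numEdges G ∸ count (λ x → adj G c x ∧ Y x)
  ∣blackOffSpokes∣ Y Yc = begin
    ∣ blackOffSpokes Y ∣                                   ≡⟨ ∣∣≡count (blackOffSpokes Y) ⟩
    count (Vec.lookup (blackOffSpokes Y))                   ≡⟨ count-cong (lookup-blackOffSpokes Y) ⟩
    count (not ∘ spokes Y)                                  ≡⟨ m+n∸m≡n (count (spokes Y)) _ ⟨
    count (spokes Y) + count (not ∘ spokes Y) ∸ count (spokes Y) ≡⟨ cong₂ _∸_ (count-complement (spokes Y)) (count-joins c Y Yc) ⟩
    numEdges G ∸ count (λ x → adj G c x ∧ Y x)             ∎
    where open ≡-Reasoning

  spoke-end : ∀ {Y s} z → Y c ≡ false → spokes Y z ≡ true → s ∈ₑ ends z → s ≢ c → Y s ≡ true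
  spoke-end {Y} z Yc spoke s∈z s≢c with anyEnd⁻ Y (ends z) (∧-true⁻ʳ (endpoint c (ends z)) spoke)
  ... | t , t∈z , Yt with ∈ₑ-third (ends z) t≢c t∈z (∧-true⁻ˡ _ spoke) s∈z
    where
    t≢c : t ≢ c
    t≢c refl = not-¬ Yt Yc
  ...   | inj₁ refl = Yt
  ...   | inj₂ refl = ⊥-elim (s≢c refl)

  spokes-mono : ∀ Y Z → (∀ v → Y v ≡ true → Z v ≡ true) → ∀ e → spokes Y e ≡ true → spokes Z e ≡ true
  spokes-mono Y Z Y⊆Z e spoke =
    let t , t∈e , Yt = anyEnd⁻ Y (ends e) (∧-true⁻ʳ (endpoint c (ends e)) spoke)
    in ∧-true⁺ (∧-true⁻ˡ _ spoke) (anyEnd⁺ Z (ends e) t∈e (Y⊆Z t Yt))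

  module _ (X : Fin n → Bool) (X⊆N : ∀ x → X x ≡ true → Adj G c x)
           (X<deg : ∀ x → X x ≡ true → count X < deg G x) where

    c∉X : X c ≡ false
    c∉X = ¬-not λ Xc → Adj⇒≢ (X⊆N c Xc) refl

    -- x has more than |X| neighbours, but at most |X| of them lie in X ∪ {c}, since x ∈ X.
    escape : ∀ x → X x ≡ true → ∃[ y ] Adj G x y × y ≢ c × X y ≡ false
    escape x Xx =
      let y , h = count-witness (λ y → adj G x y ∧ not (Q y)) outside
          y≟c , Xy = not-∨-true⁻ ⌊ y ≟ c ⌋ (∧-true⁻ʳ (adj G x y) h)
      in y , ∧-true⁻ˡ _ h , (λ y≡c → not-¬ (≡⇒≟ y≡c) y≟c) , Xy
      where
      Q : Fin n → Bool
      Q y = ⌊ y ≟ c ⌋ ∨ X y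
      inside : count (λ y → adj G x y ∧ Q y) ≤ count X
      inside = ≤-trans (count-≤-suc c in-X∖x) (≤-reflexive (sym (count-remove X x Xx)))
        where
        in-X∖x : ∀ i → i ≢ c → adj G x i ∧ Q i ≡ true → X i ∧ not ⌊ i ≟ x ⌋ ≡ true
        in-X∖x i i≢c h with ∨-true⁻ ⌊ i ≟ c ⌋ (∧-true⁻ʳ (adj G x i) h)
        ... | inj₁ i≟c = ⊥-elim (i≢c (≟⇒≡ i≟c))
        ... | inj₂ Xi  = ∧-true⁺ Xi (cong not (≢⇒≟ (Adj⇒≢ (∧-true⁻ˡ _ h) ∘ sym)))
      outside : 1 ≤ count (λ y → adj G x y ∧ not (Q y))
      outside = +-cancelˡ-≤ (count X) 1 _ (begin
        count X + 1                                                    ≡⟨ +-comm (count X) 1 ⟩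
        suc (count X)                                                  ≤⟨ X<deg x Xx ⟩
        deg G x                                                        ≡⟨ deg≡count G x ⟩
        count (adj G x)                                                ≡⟨ count-split (adj G x) Q ⟩
        count (λ y → adj G x y ∧ Q y) + count (λ y → adj G x y ∧ not (Q y)) ≤⟨ +-monoˡ-≤ _ inside ⟩
        count X + count (λ y → adj G x y ∧ not (Q y))                  ∎)
        where open ≤-Reasoning

    module ForceSpoke (X′ : Fin n → Bool) (X′⊆X : ∀ v → X′ v ≡ true → X v ≡ true) (x : Fin n) (X′x : X′ x ≡ true)
                {y} (x~y : Adj G x y) (y≢c : y ≢ c) (y∉X : X y ≡ false)
                {u} (x∈u : x ∈ₑ ends u) (y∈u : y ∈ₑ ends u)
                {w} (c∈w : c ∈ₑ ends w) (x∈w : x ∈ₑ ends w) where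

      c≢x : c ≢ x
      c≢x = Adj⇒≢ (X⊆N x (X′⊆X x X′x))

      c∉X′ : X′ c ≡ false
      c∉X′ = ¬-not (not-¬ c∉X ∘ X′⊆X c)

      X″ : Fin n → Bool
      X″ v = X′ v ∧ not ⌊ v ≟ x ⌋

      B : Subset (numEdges G)
      B = blackOffSpokes X′

      c∉u : endpoint c (ends u) ≡ false
      c∉u = ¬-not λ c∈u → [ c≢x , y≢c ∘ sym ]′ (∈ₑ-third (ends u) (Adj⇒≢ x~y) x∈u y∈u c∈u)

      u∈B : u ∈ B
      u∈B = lookup⇒∈ (trans (lookup-blackOffSpokes X′ u) (cong (λ b → not (b ∧ anyEnd X′ (ends u))) c∉u))

      w-spoke : spokes X′ w ≡ true
      w-spoke = ∧-true⁺ c∈w (anyEnd⁺ X′ (ends w) x∈w X′x)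

      w∉B : w ∉ B
      w∉B w∈B = not-¬ (∈⇒lookup w∈B) (trans (lookup-blackOffSpokes X′ w) (cong not w-spoke))

      u~w : Adj L u w
      u~w = L-adj⁺ (λ u≡w → not-¬ (subst (λ e → endpoint c (ends e) ≡ true) (sym u≡w) c∈w) c∉u) x∈u x∈w

      others-black : ∀ z → Adj L u z → z ≢ w → z ∈ B
      others-black z u~z z≢w = lookup⇒∈ (trans (lookup-blackOffSpokes X′ z) (cong not (¬-not z-not-spoke)))
        where
        z-not-spoke : spokes X′ z ≢ true
        z-not-spoke spoke with proj₂ (L-adj⁻ u~z)
        ... | s , s∈u , s∈z with ∈ₑ-third (ends u) (Adj⇒≢ x~y) x∈u y∈u s∈u
        ...   | inj₁ refl = z≢w (edge-determined z w c≢x (∧-true⁻ˡ _ spoke) s∈z c∈w x∈w)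
        ...   | inj₂ refl = not-¬ (X′⊆X s (spoke-end z c∉X′ spoke s∈z y≢c)) y∉X

      spoke-step : Force L B (B ∪ ⁅ w ⁆)
      spoke-step = force u w u∈B w∉B u~w others-black

      spokes-X″ : ∀ e → e ≢ w → spokes X′ e ≡ spokes X″ e
      spokes-X″ e e≢w = Bool-ext drop-x (spokes-mono X″ X′ (λ v → ∧-true⁻ˡ (not ⌊ v ≟ x ⌋)) e)
        where
        drop-x : spokes X′ e ≡ true → spokes X″ e ≡ true
        drop-x spoke with anyEnd⁻ X′ (ends e) (∧-true⁻ʳ (endpoint c (ends e)) spoke)
        ... | t , t∈e , X′t with t ≟ x
        ...   | yes refl = ⊥-elim (e≢w (edge-determined e w c≢x (∧-true⁻ˡ _ spoke) t∈e c∈w x∈w))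
        ...   | no t≢x  = ∧-true⁺ (∧-true⁻ˡ _ spoke) (anyEnd⁺ X″ (ends e) t∈e (∧-true⁺ X′t (cong not (≢⇒≟ t≢x))))

      w-not-spoke-X″ : spokes X″ w ≡ false
      w-not-spoke-X″ = ¬-not λ spoke →
        not-¬ (spoke-end w (cong (_∧ not ⌊ c ≟ x ⌋) c∉X′) spoke x∈w (c≢x ∘ sym))
              (trans (cong (λ b → X′ x ∧ not b) (≟-refl x)) (∧-zeroʳ (X′ x)))

      after-step : B ∪ ⁅ w ⁆ ≡ blackOffSpokes X″
      after-step = trans (sym (Vec.tabulate∘lookup (B ∪ ⁅ w ⁆))) (Vec.tabulate-cong pointwise)
        where
        pointwise : ∀ e → Vec.lookup (B ∪ ⁅ w ⁆) e ≡ not (spokes X″ e)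
        pointwise e with e ≟ w | lookup-∪⁅⁆ B w e
        ... | yes refl | eq = trans eq (trans (∨-zeroʳ _) (cong not (sym w-not-spoke-X″)))
        ... | no e≢w   | eq = trans eq (trans (∨-identityʳ _) (trans (lookup-blackOffSpokes X′ e) (cong not (spokes-X″ e e≢w))))

    blackOffSpokes-isZeroForcing : ∀ k X′ → (∀ v → X′ v ≡ true → X v ≡ true) → count X′ ≡ k →
                       IsZeroForcingSet L (blackOffSpokes X′)
    blackOffSpokes-isZeroForcing zero X′ _ empty = blackOffSpokes X′ , ε , all-black
      where
      all-black : ∀ e → e ∈ blackOffSpokes X′
      all-black e = lookup⇒∈ (trans (lookup-blackOffSpokes X′ e) (cong not (trans
        (cong (endpoint c (ends e) ∧_) (cong₂ _∨_ (count≡0 empty (proj₁ (ends e))) (count≡0 empty (proj₂ (ends e)))))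
        (∧-zeroʳ _))))
    blackOffSpokes-isZeroForcing (suc k) X′ X′⊆X size with count-witness X′ (≤-trans (s≤s z≤n) (≤-reflexive (sym size)))
    ... | x , X′x with escape x (X′⊆X x X′x)
    ...   | y , x~y , y≢c , y∉X with edge-joining x~y | edge-joining (X⊆N x (X′⊆X x X′x))
    ...     | u , x∈u , y∈u | w , c∈w , x∈w =
      let T , chain , all-black = blackOffSpokes-isZeroForcing k X″ (λ v → X′⊆X v ∘ ∧-true⁻ˡ _) size″
      in T , spoke-step ◅ subst (λ B → Star (Force L) B T) (sym after-step) chain , all-black
      where
      open ForceSpoke X′ X′⊆X x X′x x~y y≢c y∉X x∈u y∈u c∈w x∈w
      size″ : count X″ ≡ k
      size″ = suc-injective (trans (sym (count-remove X′ x X′x)) size)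

    blackOffSpokes-X-isZeroForcing : IsZeroForcingSet L (blackOffSpokes X)
    blackOffSpokes-X-isZeroForcing = blackOffSpokes-isZeroForcing (count X) X (λ _ Xv → Xv) refl

    ∣blackOffSpokes-X∣ : ∣ blackOffSpokes X ∣ ≡ numEdges G ∸ count X
    ∣blackOffSpokes-X∣ = trans (∣blackOffSpokes∣ X c∉X)
      (cong (numEdges G ∸_) (count-cong λ v → Bool-ext (∧-true⁻ʳ (adj G c v)) (λ Xv → ∧-true⁺ (X⊆N v Xv) Xv)))

module WhiteEdges {n : ℕ} (G : Graph n) (simple : Simple G) where

  open LineGraph G simple

  white : Subset (numEdges G) → Fin (numEdges G) → Bool
  white B e = not (Vec.lookup B e)

  covered : Subset (numEdges G) → Fin n → Bool
  covered B x = anyᶠ (λ e → white B e ∧ endpoint x (ends e))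

  white-∪⁅⁆ : ∀ B w e → white (B ∪ ⁅ w ⁆) e ≡ white B e ∧ not ⌊ e ≟ w ⌋
  white-∪⁅⁆ B w e = trans (cong not (lookup-∪⁅⁆ B w e)) (deMorgan₂ (Vec.lookup B e) ⌊ e ≟ w ⌋)

  all-black⇒no-white : ∀ {T} → (∀ e → e ∈ T) → count (white T) ≡ 0
  all-black⇒no-white all-black = sum-zero λ e → cong (indicator ∘ not) (∈⇒lookup (all-black e))

  white-covers : ∀ B e x → white B e ≡ true → x ∈ₑ ends e → covered B x ≡ true
  white-covers B e x e-white x∈e = anyᶠ⁺ e (∧-true⁺ e-white x∈e)

  covered-antitone : ∀ B w x → covered (B ∪ ⁅ w ⁆) x ≡ true → covered B x ≡ true
  covered-antitone B w x h =
    let e , h′ = anyᶠ⁻ (λ e → white (B ∪ ⁅ w ⁆) e ∧ endpoint x (ends e)) h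
    in white-covers B e x (∧-true⁻ˡ _ (trans (sym (white-∪⁅⁆ B w e)) (∧-true⁻ˡ _ h′))) (∧-true⁻ʳ _ h′)

  force-removes-white : ∀ {B B′} → Force L B B′ → count (white B) ≡ suc (count (white B′))
  force-removes-white {B} (force u w _ w∉B _ _) =
    trans (count-remove (white B) w (cong not (∉⇒lookup w∉B))) (cong suc (count-cong (sym ∘ white-∪⁅⁆ B w)))

  black-next-to-forcer : ∀ {B u w} → u ∈ B → (∀ z → Adj L u z → z ≢ w → z ∈ B) →
                         ∀ {s} e → s ∈ₑ ends u → s ∈ₑ ends e → e ≢ w → e ∈ B
  black-next-to-forcer {u = u} u∈B others e s∈u s∈e e≢w with e ≟ u
  ... | yes refl = u∈B
  ... | no  e≢u  = others e (L-adj⁺ (e≢u ∘ sym) s∈u s∈e) e≢w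

  uncovered-if-black : ∀ B x → (∀ e → x ∈ₑ ends e → e ∈ B) → covered B x ≡ false
  uncovered-if-black B x black = ¬-not λ h →
    let e , h′ = anyᶠ⁻ (λ e → white B e ∧ endpoint x (ends e)) h
    in not-¬ (∈⇒lookup (black e (∧-true⁻ʳ _ h′))) (not-true⁻ (∧-true⁻ˡ _ h′))

  force-uncovers : ∀ {B B′} → Force L B B′ → suc (count (covered B′)) ≤ count (covered B)
  force-uncovers {B} (force u w u∈B w∉B u~w others) with proj₂ (L-adj⁻ u~w)
  ... | a , a∈u , a∈w =
    count-insert a (covered-antitone B w) (uncovered-if-black (B ∪ ⁅ w ⁆) a black-at-a)
                 (white-covers B w a (cong not (∉⇒lookup w∉B)) a∈w)
    where
    black-at-a : ∀ e → a ∈ₑ ends e → e ∈ B ∪ ⁅ w ⁆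
    black-at-a e a∈e with e ≟ w
    ... | yes refl = x∈p∪q⁺ (inj₂ (x∈⁅x⁆ e))
    ... | no  e≢w  = x∈p∪q⁺ (inj₁ (black-next-to-forcer u∈B others e a∈u a∈e e≢w))

  white<covered : ∀ {B T} → Star (Force L) B T → (∀ e → e ∈ T) → 1 ≤ count (white B) →
                  suc (count (white B)) ≤ count (covered B)
  white<covered ε all-black pos = ⊥-elim (1+n≰n (≤-trans pos (≤-reflexive (all-black⇒no-white all-black))))
  white<covered {B} (step@(force u w _ w∉B _ _) ◅ rest) all-black pos with 1 ≤? count (white (B ∪ ⁅ w ⁆))
  ... | yes pos′ = begin
    suc (count (white B))                  ≡⟨ cong suc (force-removes-white step) ⟩
    suc (suc (count (white (B ∪ ⁅ w ⁆))))  ≤⟨ s≤s (white<covered rest all-black pos′) ⟩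
    suc (count (covered (B ∪ ⁅ w ⁆)))      ≤⟨ force-uncovers step ⟩
    count (covered B)                      ∎
    where open ≤-Reasoning
  ... | no ≰1 = begin
    suc (count (white B))                  ≡⟨ cong suc (force-removes-white step) ⟩
    suc (suc (count (white (B ∪ ⁅ w ⁆))))  ≡⟨ cong (λ k → suc (suc k)) (≰1⇒≡0 ≰1) ⟩
    2
      ≤⟨ count-two _ _ (ends-distinct w) (w-covers (proj₁∈ₑ (ends w))) (w-covers (proj₂∈ₑ (ends w))) ⟩
    count (covered B)                      ∎
    where
    open ≤-Reasoning
    w-covers : ∀ {x} → x ∈ₑ ends w → covered B x ≡ true
    w-covers = white-covers B w _ (cong not (∉⇒lookup w∉B))

  -- The forcing edge u has an endpoint o off the edge w it forces; every edge at o is black.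
  white≤n∸2 : ∀ S → IsZeroForcingSet L S → count (white S) ≤ n ∸ 2
  white≤n∸2 S zf with 1 ≤? count (white S)
  white≤n∸2 S zf                                   | no ≰1 = ≤-trans (≤-reflexive (≰1⇒≡0 ≰1)) z≤n
  white≤n∸2 S (T , ε , all-black)                  | yes pos = ⊥-elim (1+n≰n (≤-trans pos (≤-reflexive (all-black⇒no-white all-black))))
  white≤n∸2 S (T , chain@(force u w u∈S w∉S u~w others ◅ _) , all-black) | yes pos
    with proj₂ (L-adj⁻ u~w)
  ... | a , a∈u , a∈w with other-end u a∈u
  ...   | o , o∈u , o≢a =
    ≤-trans (≤-reflexive (sym (m+n∸n≡m (count (white S)) 2))) (∸-monoˡ-≤ 2 (begin
      count (white S) + 2                ≡⟨ +-comm (count (white S)) 2 ⟩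
      suc (suc (count (white S)))        ≤⟨ s≤s (white<covered chain all-black pos) ⟩
      suc (count (covered S))            ≤⟨ count-insert o (λ _ _ → refl) (uncovered-if-black S o black-at-o) refl ⟩
      count {n} (λ _ → true)             ≡⟨ count-const ⟩
      n                                  ∎))
    where
    open ≤-Reasoning
    black-at-o : ∀ e → o ∈ₑ ends e → e ∈ S
    black-at-o e o∈e with e ≟ w
    ... | yes e≡w = ⊥-elim (w∉S (subst (_∈ S) u≡w u∈S))
      where
      u≡w : u ≡ w
      u≡w = trans (edge-determined u e o≢a o∈u a∈u o∈e (subst (λ f → a ∈ₑ ends f) (sym e≡w) a∈w)) e≡w
    ... | no  e≢w  = black-next-to-forcer u∈S others e o∈u o∈e e≢w

-- The bounds and their sharpness

maxDeg∸1≤ : ∀ {n} (G : Graph n) → Simple G → ∀ S → IsZeroForcingSet (lineGraph G) S → maxDeg G ∸ 1 ≤ ∣ S ∣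
maxDeg∸1≤ {zero}  G _      S _  = z≤n
maxDeg∸1≤ {suc n} G simple S zf =
  let c , max≤deg = maxDeg-attained G
  in ≤-trans (∸-monoˡ-≤ 1 max≤deg) (LineGraph.incident-bound G simple c S zf)

spokes-zeroForcingSet : ∀ {n} (G : Graph n) → Simple G → Fin n →
                        ∃[ S ] IsZeroForcingSet (lineGraph G) S × ∣ S ∣ ≡ numEdges G ∸ (minDeg G ∸ 1)
spokes-zeroForcingSet G simple c
  with count-choose (adj G c) (≤-trans (m∸n≤m _ 1) (≤-trans (minDeg≤deg G c) (≤-reflexive (deg≡count G c))))
... | X , X⊆N , size =
  blackOffSpokes X , blackOffSpokes-X-isZeroForcing X X⊆N X<deg , trans (∣blackOffSpokes-X∣ X X⊆N X<deg) (cong (numEdges G ∸_) size)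
  where
  open Spokes G simple c
  pred< : ∀ d → 1 ≤ d ∸ 1 → d ∸ 1 < d
  pred< (suc d) _ = n<1+n d
  X<deg : ∀ x → X x ≡ true → count X < deg G x
  X<deg x Xx = begin-strict
    count X         ≡⟨ size ⟩
    minDeg G ∸ 1    <⟨ pred< (minDeg G) (≤-trans (count-pos x Xx) (≤-reflexive size)) ⟩
    minDeg G        ≤⟨ minDeg≤deg G x ⟩
    deg G x         ∎
    where open ≤-Reasoning

numEdges∸[n∸2]≤ : ∀ {n} (G : Graph n) → Simple G → ∀ S → IsZeroForcingSet (lineGraph G) S → numEdges G ∸ (n ∸ 2) ≤ ∣ S ∣
numEdges∸[n∸2]≤ {n} G simple S zf = begin
  numEdges G ∸ (n ∸ 2)                               ≤⟨ ∸-monoʳ-≤ (numEdges G) (white≤n∸2 S zf) ⟩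
  numEdges G ∸ count (white S)                       ≡⟨ cong (_∸ count (white S)) (count-complement (Vec.lookup S)) ⟨
  count (Vec.lookup S) + count (white S) ∸ count (white S) ≡⟨ m+n∸n≡m (count (Vec.lookup S)) (count (white S)) ⟩
  count (Vec.lookup S)                               ≡⟨ ∣∣≡count S ⟨
  ∣ S ∣                                              ∎
  where
  open ≤-Reasoning
  open WhiteEdges G simple

star-simple : ∀ m → Simple (star m)
star-simple m = symmetric , irreflexive
  where
  symmetric : ∀ u v → starAdj u v ≡ starAdj v u
  symmetric zero    zero    = refl
  symmetric zero    (suc _) = refl
  symmetric (suc _) zero    = refl
  symmetric (suc _) (suc _) = refl
  irreflexive : ∀ u → starAdj u u ≡ false
  irreflexive zero    = refl
  irreflexive (suc _) = refl

star-edge-at-centre : ∀ {m} (p q : Fin (suc m)) → starAdj p q ≡ true → p ≡ zero ⊎ q ≡ zero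
star-edge-at-centre zero    _    _ = inj₁ refl
star-edge-at-centre (suc _) zero _ = inj₂ refl

-- L(G) is then complete on at most deg c ≤ Δ vertices, and any vertex but one forces it.
edges-at-one-vertex⇒Z≡Δ∸1 : ∀ {n} (G : Graph n) (simple : Simple G) (c : Fin n) → (∀ e → LineGraph.incident G simple c e ≡ true) →
                ∀ {a b} → Adj G c a → Adj G c b → a ≢ b → ZeroForcingNumber (lineGraph G) (maxDeg G ∸ 1)
edges-at-one-vertex⇒Z≡Δ∸1 G simple c all-incident c~a c~b a≢b with LineGraph.edges-at-common-vertex G simple c~a c~b a≢b
... | e , f , e≢f , e~f =
  (∁ ⁅ f ⁆ , zf , ≤-antisym ∣∁⁅f⁆∣≤ (maxDeg∸1≤ G simple (∁ ⁅ f ⁆) zf)) , maxDeg∸1≤ G simple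
  where
  open LineGraph G simple
  open ZeroForcing L
  zf : IsZeroForcingSet L (∁ ⁅ f ⁆)
  zf = ∁⁅⁆-isZeroForcing e≢f e~f
  ∣∁⁅f⁆∣≤ : ∣ ∁ ⁅ f ⁆ ∣ ≤ maxDeg G ∸ 1
  ∣∁⁅f⁆∣≤ = ≤-trans (≤-reflexive (∣∁⁅⁆∣ f)) (∸-monoˡ-≤ 1 (begin
    numEdges G                         ≡⟨ count-const ⟨
    count {numEdges G} (λ _ → true)    ≤⟨ count-mono (λ e _ → all-incident e) ⟩
    count (incident c)                 ≡⟨ count-incident c ⟩
    deg G c                            ≤⟨ deg≤maxDeg G c ⟩
    maxDeg G                           ∎))
    where open ≤-Reasoning

star-sharp : ∀ m → 2 ≤ m → ZeroForcingNumber (lineGraph (star m)) (maxDeg (star m) ∸ 1)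
star-sharp (suc zero) (s≤s ())
star-sharp m@(suc (suc _)) _ = edges-at-one-vertex⇒Z≡Δ∸1 (star m) simple zero all-incident {suc zero} {suc (suc zero)} refl refl λ ()
  where
  simple : Simple (star m)
  simple = star-simple m
  open LineGraph (star m) simple
  all-incident : ∀ e → incident zero e ≡ true
  all-incident e with star-edge-at-centre (proj₁ (ends e)) (proj₂ (ends e)) (ends-adj e)
  ... | inj₁ p≡0 = subst (λ x → endpoint x (ends e) ≡ true) p≡0 (proj₁∈ₑ (ends e))
  ... | inj₂ q≡0 = subst (λ x → endpoint x (ends e) ≡ true) q≡0 (proj₂∈ₑ (ends e))

complete-simple : ∀ n → Simple (complete n)
complete-simple n = (λ u v → cong not (≟-sym u v)) , (λ u → cong not (≟-refl u))

complete-deg : ∀ n (x : Fin n) → deg (complete n) x ≡ n ∸ 1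
complete-deg n x = begin
  deg (complete n) x                                    ≡⟨ deg≡count (complete n) x ⟩
  count (λ y → not ⌊ x ≟ y ⌋)                           ≡⟨ m+n∸m≡n 1 _ ⟨
  1 + count (λ y → not ⌊ x ≟ y ⌋) ∸ 1                   ≡⟨ cong (λ k → k + count (λ y → not ⌊ x ≟ y ⌋) ∸ 1) x-once ⟨
  count (λ y → ⌊ x ≟ y ⌋) + count (λ y → not ⌊ x ≟ y ⌋) ∸ 1 ≡⟨ cong (_∸ 1) (count-complement (λ y → ⌊ x ≟ y ⌋)) ⟩
  n ∸ 1                                                 ∎
  where
  open ≡-Reasoning
  x-once : count (λ y → ⌊ x ≟ y ⌋) ≡ 1
  x-once = trans (count-cong (≟-sym x)) (count-singleton x)

complete-sharp : ∀ n → 2 ≤ n →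
  ZeroForcingNumber (lineGraph (complete n)) (numEdges (complete n) ∸ (minDeg (complete n) ∸ 1))
complete-sharp n@(suc _) _ =
  spokes-zeroForcingSet (complete n) (complete-simple n) zero ,
  λ S zf → ≤-trans (∸-monoʳ-≤ (numEdges (complete n)) n∸2≤δ∸1) (numEdges∸[n∸2]≤ (complete n) (complete-simple n) S zf)
  where
  n∸2≤δ∸1 : n ∸ 2 ≤ minDeg (complete n) ∸ 1
  n∸2≤δ∸1 = ∸-monoˡ-≤ 1 (minDeg-glb (complete n) (λ x → ≤-reflexive (sym (complete-deg n x))))

line-graph-bounds : (n : ℕ) → 2 ≤ n → (G : Graph n) → Simple G → Connected G →
                    (k : ℕ) → ZeroForcingNumber (lineGraph G) k →
                    (maxDeg G ∸ 1 ≤ k) × (k ≤ numEdges G ∸ (minDeg G ∸ 1))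
line-graph-bounds (suc n) _ G simple _ k ((S , zf , ∣S∣≡k) , minimal) =
  let S′ , zf′ , ∣S′∣≡ = spokes-zeroForcingSet G simple zero
  in subst (maxDeg G ∸ 1 ≤_) ∣S∣≡k (maxDeg∸1≤ G simple S zf) , ≤-trans (minimal S′ zf′) (≤-reflexive ∣S′∣≡)

proposition3p6 :
    ((n : ℕ) → 2 ≤ n → (G : Graph n) → Simple G → Connected G →
      (k : ℕ) → ZeroForcingNumber (lineGraph G) k →
      (maxDeg G ∸ 1 ≤ k) × (k ≤ numEdges G ∸ (minDeg G ∸ 1)))
    × ((m : ℕ) → 2 ≤ m →
      ZeroForcingNumber (lineGraph (star m)) (maxDeg (star m) ∸ 1))
    × ((n : ℕ) → 2 ≤ n →
      ZeroForcingNumber (lineGraph (complete n)) (numEdges (complete n) ∸ (minDeg (complete n) ∸ 1)))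
proposition3p6 = line-graph-bounds , star-sharp , complete-sharp
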